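{- Let $P_1,P_2$ be finite posets, and let $Q_1\in M(P_1)$ and $Q_2\in M(P_2)$. Then $Q_1'\in M(P_1')$ and $Q_1^{Q_2}\in M(P_1^{P_2})$.
   Context: All posets are finite. A copy of $P$ in $Q$ is a subset of $Q$ which with the induced order is isomorphic to $P$. A coloring of a poset is proper if comparable distinct elements get distinct colors; a copy is rainbow if its elements get pairwise distinct colors; $Q$ rainbow forces $P$ if every proper coloring of $Q$ admits a rainbow copy of $P$. $M(P)$ is the set of posets $Q$ that rainbow force $P$ but such that $Q\setminus\{q\}$ does not rainbow force $P$ for any $q\in Q$. The dual $P'$ of $(P,\leqslant)$ is $(P,\leqslant')$ with $x\leqslant' y$ iff $y\leqslant x$. For posets $P,Q$ (on disjoint ground sets), $P^Q$ is the poset on $P\cup Q$ with the relations inherited from $P$ and from $Q$ together with $p\leqslant q$ for all $p\in P$, $q\in Q$. -}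

module Defs where

open import Data.Nat using (ℕ; suc)
open import Data.Fin using (Fin; zero; suc; punchIn; splitAt; join)
open import Data.Fin.Properties using (punchIn-injective; join-splitAt)
open import Data.Sum using (_⊎_; inj₁; inj₂)
open import Data.Unit using (⊤; tt)
open import Data.Empty using (⊥)
open import Data.Product using (Σ; _×_; _,_)
open import Function.Definitions using (Injective)
open import Relation.Nullary using (¬_)
open import Relation.Binary.PropositionalEquality using (_≡_; _≢_; refl; cong; trans; sym)

record FinPoset : Set₁ where
  field
    size    : ℕ
    _≤_     : Fin size → Fin size → Set
    ≤-refl  : ∀ x → x ≤ x
    ≤-antisym : ∀ {x y} → x ≤ y → y ≤ x → x ≡ y
    ≤-trans : ∀ {x y z} → x ≤ y → y ≤ z → x ≤ z

open FinPoset public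

El : FinPoset → Set
El P = Fin (size P)

-- A copy of P in Q: an order embedding f : P → Q (its image is a subset of Q
-- which, with the induced order, is isomorphic to P via f).
record Copy (P Q : FinPoset) : Set where
  field
    emb     : El P → El Q
    emb-inj : Injective _≡_ _≡_ emb
    emb-ord : ∀ x y → (_≤_ P x y → _≤_ Q (emb x) (emb y)) × (_≤_ Q (emb x) (emb y) → _≤_ P x y)

open Copy public

Coloring : FinPoset → Set
Coloring Q = El Q → ℕ

Proper : (Q : FinPoset) → Coloring Q → Set
Proper Q c = ∀ x y → _≤_ Q x y → x ≢ y → c x ≢ c y

Rainbow : {P Q : FinPoset} → Coloring Q → Copy P Q → Set
Rainbow {P} c f = ∀ x y → c (emb f x) ≡ c (emb f y) → x ≡ y

RainbowForces : (Q P : FinPoset) → Set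
RainbowForces Q P = (c : Coloring Q) → Proper Q c → Σ (Copy P Q) (λ f → Rainbow c f)

delete : (Q : FinPoset) → El Q → FinPoset
delete record { size = suc k ; _≤_ = R ; ≤-refl = rf ; ≤-antisym = as ; ≤-trans = tr } q = record
  { size = k
  ; _≤_ = λ x y → R (punchIn q x) (punchIn q y)
  ; ≤-refl = λ x → rf (punchIn q x)
  ; ≤-antisym = λ p r → punchIn-injective q _ _ (as p r)
  ; ≤-trans = tr
  }

M : FinPoset → FinPoset → Set
M P Q = RainbowForces Q P × (∀ (q : El Q) → ¬ RainbowForces (delete Q q) P)

dual : FinPoset → FinPoset
dual P = record
  { size = size P
  ; _≤_ = λ x y → _≤_ P y x
  ; ≤-refl = ≤-refl P
  ; ≤-antisym = λ p q → ≤-antisym P q p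
  ; ≤-trans = λ p q → ≤-trans P q p
  }

-- Ordinal sum P^Q: ground set Fin (size P + size Q), first block = P, second = Q,
-- every element of P below every element of Q.
module _ {a b : ℕ} (R : Fin a → Fin a → Set) (S : Fin b → Fin b → Set) where
  sumRel : Fin a ⊎ Fin b → Fin a ⊎ Fin b → Set
  sumRel (inj₁ x) (inj₁ y) = R x y
  sumRel (inj₁ x) (inj₂ y) = ⊤
  sumRel (inj₂ x) (inj₁ y) = ⊥
  sumRel (inj₂ x) (inj₂ y) = S x y

ordSum : FinPoset → FinPoset → FinPoset
ordSum P Q = record
  { size = size P Data.Nat.+ size Q
  ; _≤_ = λ x y → sumRel (_≤_ P) (_≤_ Q) (splitAt (size P) x) (splitAt (size P) y)
  ; ≤-refl = λ x → rfl (splitAt (size P) x)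
  ; ≤-antisym = λ {x} {y} p r →
      trans (sym (join-splitAt (size P) (size Q) x))
        (trans (cong (join (size P) (size Q)) (asym (splitAt (size P) x) (splitAt (size P) y) p r))
               (join-splitAt (size P) (size Q) y))
  ; ≤-trans = λ {x} {y} {z} → trn (splitAt (size P) x) (splitAt (size P) y) (splitAt (size P) z)
  }
  where
  rfl : ∀ u → sumRel (_≤_ P) (_≤_ Q) u u
  rfl (inj₁ x) = ≤-refl P x
  rfl (inj₂ x) = ≤-refl Q x
  asym : ∀ u v → sumRel (_≤_ P) (_≤_ Q) u v → sumRel (_≤_ P) (_≤_ Q) v u → u ≡ v
  asym (inj₁ x) (inj₁ y) p r = cong inj₁ (≤-antisym P p r)
  asym (inj₁ x) (inj₂ y) p ()
  asym (inj₂ x) (inj₁ y) () r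
  asym (inj₂ x) (inj₂ y) p r = cong inj₂ (≤-antisym Q p r)
  trn : ∀ u v w → sumRel (_≤_ P) (_≤_ Q) u v → sumRel (_≤_ P) (_≤_ Q) v w → sumRel (_≤_ P) (_≤_ Q) u w
  trn (inj₁ x) (inj₁ y) (inj₁ z) p r = ≤-trans P p r
  trn (inj₁ x) _ (inj₂ z) p r = tt
  trn (inj₁ x) (inj₂ y) (inj₁ z) p ()
  trn (inj₂ x) (inj₁ y) _ () r
  trn (inj₂ x) (inj₂ y) (inj₁ z) p ()
  trn (inj₂ x) (inj₂ y) (inj₂ z) p r = ≤-trans Q p r

-- Duality is immediate: proper colorings of Q′ are those of Q, and copies of P′ in Q′ are copies
-- of P in Q. For Q₁^Q₂, rainbow copies of P₁ in Q₁ and of P₂ in Q₂ combine, colors below always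
-- differing from colors above. For minimality, deleting a point of the upper part reduces by
-- duality, (Q₁^Q₂)′ ≅ Q₂′^Q₁′, to deleting a point q of the lower part. Color Q₁ ∖ q with any
-- proper coloring (even colors), and Q₂ (odd colors) by a proper coloring of Q₂ ∖ m without
-- rainbow P₂, m minimal in Q₂, giving m a fresh color: then no rainbow P₂ lies strictly above a
-- point of Q₂. A rainbow copy of P₁^P₂ avoiding q therefore maps all of P₁ into Q₁, and so
-- Q₁ ∖ q would force P₁. Constructively the bad coloring of Q₂ ∖ m is only available under a
-- double negation; as the goal is ⊥ this suffices, since with the orders decidable (again up to
-- double negation) so is the existence of a rainbow copy.

module Submission where

open import Defs
open import Data.Empty using (⊥; ⊥-elim)
open import Data.Fin using (Fin; zero; suc; _↑ˡ_; _↑ʳ_; splitAt; join; punchIn; finToFun; funToFin; _≟_)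
open import Data.Fin.Induction using (po-wellFounded)
open import Data.Fin.Properties
  using (any?; all?; ∀-cons; splitAt-↑ˡ; splitAt-↑ʳ; splitAt⁻¹-↑ˡ; splitAt⁻¹-↑ʳ; splitAt-join;
         punchInᵢ≢i; punchIn-punchOut; finToFun-funToFin)
open import Data.Nat using (ℕ; _+_; _*_; suc) renaming (_≟_ to _≟ℕ_)
open import Data.Nat.Properties using (*-cancelˡ-≡; even≢odd; suc-injective)
open import Data.Product using (Σ; ∃; _×_; _,_; proj₁; proj₂)
open import Data.Sum as Sum using (_⊎_; inj₁; inj₂; [_,_]′)
open import Data.Unit using (tt)
open import Function using (_∘_; id; flip)
open import Induction.WellFounded using (Acc; acc)
open import Relation.Binary.Construct.NonStrictToStrict using () renaming (_<_ to Strict)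
open import Relation.Binary.Definitions using (Decidable)
open import Relation.Binary.PropositionalEquality
  using (_≡_; _≢_; _≗_; refl; sym; trans; cong; subst; subst₂; isEquivalence)
open import Relation.Binary.Structures using (IsPartialOrder)
open import Relation.Nullary using (¬_; Dec; yes; no; ¬?)
open import Relation.Nullary.Decidable using (map′; _×-dec_; _→-dec_; decidable-stable; ¬¬-excluded-middle)

private variable
  P Q R P′ Q′ P₁ P₂ Q₁ Q₂ : FinPoset

¬¬-∀-Fin : ∀ {n} {A : Fin n → Set} → (∀ i → ¬ ¬ A i) → ¬ ¬ (∀ i → A i)
¬¬-∀-Fin {ℕ.zero} _ k = k λ ()
¬¬-∀-Fin {suc n} h k = h zero λ a₀ → ¬¬-∀-Fin (h ∘ suc) λ a → k (∀-cons a₀ a)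

any-function? : ∀ {m n} {A : (Fin m → Fin n) → Set} →
  (∀ {f g} → f ≗ g → A f → A g) → (∀ f → Dec (A f)) → Dec (∃ A)
any-function? resp A? =
  map′ (λ (k , a) → finToFun k , a) (λ (f , a) → funToFin f , resp (sym ∘ finToFun-funToFin f) a)
       (any? (A? ∘ finToFun))

fin-empty-or-inhabited : ∀ n → ¬ Fin n ⊎ Fin n
fin-empty-or-inhabited ℕ.zero = inj₁ λ ()
fin-empty-or-inhabited (suc n) = inj₂ zero

¬¬-decidable : ∀ Q → ¬ ¬ Decidable (_≤_ Q)
¬¬-decidable Q = ¬¬-∀-Fin λ x → ¬¬-∀-Fin λ y → ¬¬-excluded-middle

isPartialOrder : ∀ Q → IsPartialOrder _≡_ (_≤_ Q)
isPartialOrder Q = record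
  { isPreorder = record { isEquivalence = isEquivalence ; reflexive = λ { refl → ≤-refl Q _ } ; trans = ≤-trans Q }
  ; antisym = ≤-antisym Q
  }

IsMinimal : ∀ Q → El Q → Set
IsMinimal Q m = ∀ y → _≤_ Q y m → y ≡ m

minimal-below : Decidable (_≤_ Q) → ∀ x → Acc (Strict (_≡_ {A = El Q}) (_≤_ Q)) x → Σ (El Q) (IsMinimal Q)
minimal-below {Q} Q? x (acc below) with any? (λ y → Q? y x ×-dec ¬? (y ≟ x))
... | yes (y , y<x) = minimal-below {Q} Q? y (below y<x)
... | no ∄y<x = x , λ y y≤x → decidable-stable (y ≟ x) λ y≢x → ∄y<x (y , y≤x , y≢x)

minimal-exists : Decidable (_≤_ Q) → El Q → Σ (El Q) (IsMinimal Q)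
minimal-exists {Q} Q? x = minimal-below {Q} Q? x (po-wellFounded (isPartialOrder Q) x)

OrderEmbedding : (P Q : FinPoset) → (El P → El Q) → Set
OrderEmbedding P Q f = ∀ x y → (_≤_ P x y → _≤_ Q (f x) (f y)) × (_≤_ Q (f x) (f y) → _≤_ P x y)

mkCopy : (f : El P → El Q) → OrderEmbedding P Q f → Copy P Q
mkCopy {P} {Q} f ord = record { emb = f ; emb-inj = injective ; emb-ord = ord }
  where
  injective : ∀ {x y} → f x ≡ f y → x ≡ y
  injective {x} {y} fx≡fy = ≤-antisym P
    (proj₂ (ord x y) (subst (_≤_ Q (f x)) fx≡fy (≤-refl Q (f x))))
    (proj₂ (ord y x) (subst (flip (_≤_ Q) (f x)) fx≡fy (≤-refl Q (f x))))

infixr 9 _∘ᶜ_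
_∘ᶜ_ : Copy Q R → Copy P Q → Copy P R
φ ∘ᶜ f = mkCopy (emb φ ∘ emb f) λ x y →
  proj₁ (emb-ord φ _ _) ∘ proj₁ (emb-ord f x y) , proj₂ (emb-ord f x y) ∘ proj₂ (emb-ord φ _ _)

dual-copy : Copy P Q → Copy (dual P) (dual Q)
dual-copy f = mkCopy (emb f) λ x y → emb-ord f y x

module _ {P Q Q′ : FinPoset} (G : Copy P Q) (φ : Copy Q′ Q) (G⊆φ : ∀ x → ∃ λ y → emb φ y ≡ emb G x) where

  factor : Copy P Q′
  factor = mkCopy (proj₁ ∘ G⊆φ) λ x y →
      (λ x≤y → proj₂ (emb-ord φ _ _) (subst₂ (_≤_ Q) (sym (eq x)) (sym (eq y)) (proj₁ (emb-ord G x y) x≤y)))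
    , (λ le → proj₂ (emb-ord G x y) (subst₂ (_≤_ Q) (eq x) (eq y) (proj₁ (emb-ord φ _ _) le)))
    where
    eq : ∀ x → emb φ (proj₁ (G⊆φ x)) ≡ emb G x
    eq = proj₂ ∘ G⊆φ

  factor-rainbow : ∀ c → Rainbow c G → Rainbow (c ∘ emb φ) factor
  factor-rainbow c rainbow x y e =
    rainbow x y (trans (cong c (sym (proj₂ (G⊆φ x)))) (trans e (cong c (proj₂ (G⊆φ y)))))

rainbow-resp-≗ : ∀ {c c′ : Coloring Q} (f : Copy P Q) → c ≗ c′ → Rainbow c f → Rainbow c′ f
rainbow-resp-≗ _ c≗c′ rainbow x y e = rainbow x y (trans (c≗c′ _) (trans e (sym (c≗c′ _))))

proper-∘ : ∀ {c : Coloring Q} (φ : Copy Q′ Q) → Proper Q c → Proper Q′ (c ∘ emb φ)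
proper-∘ φ proper x y x≤y x≢y = proper _ _ (proj₁ (emb-ord φ x y) x≤y) (x≢y ∘ emb-inj φ)

ProperAway : ∀ Q → El Q → Coloring Q → Set
ProperAway Q q c = ∀ x y → x ≢ q → y ≢ q → _≤_ Q x y → x ≢ y → c x ≢ c y

RainbowCopyAvoiding : (P Q : FinPoset) → El Q → Coloring Q → Set
RainbowCopyAvoiding P Q q c = Σ (Copy P Q) λ f → Rainbow c f × (∀ p → emb f p ≢ q)

ForcesAvoiding : (Q : FinPoset) → El Q → FinPoset → Set
ForcesAvoiding Q q P = ∀ c → ProperAway Q q c → RainbowCopyAvoiding P Q q c

NoDeletionForces : FinPoset → FinPoset → Set
NoDeletionForces Q P = ∀ q → ¬ ForcesAvoiding Q q P

deletion-copy : ∀ Q q → Copy (delete Q q) Q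
deletion-copy record { size = suc _ } q = mkCopy (punchIn q) λ x y → id , id

deletion-avoids : ∀ Q q x → emb (deletion-copy Q q) x ≢ q
deletion-avoids record { size = suc _ } q x = punchInᵢ≢i q x

deletion-onto : ∀ Q q {x} → x ≢ q → ∃ λ y → emb (deletion-copy Q q) y ≡ x
deletion-onto record { size = suc _ } q x≢q = _ , punchIn-punchOut (x≢q ∘ sym)

forces-delete⇒forcesAvoiding : ∀ Q q → RainbowForces (delete Q q) P → ForcesAvoiding Q q P
forces-delete⇒forcesAvoiding Q q H c proper =
  δ ∘ᶜ proj₁ copy , proj₂ copy , deletion-avoids Q q ∘ emb (proj₁ copy)
  where
  δ = deletion-copy Q q
  copy = H (c ∘ emb δ) λ x y x≤y x≢y →
    proper _ _ (deletion-avoids Q q x) (deletion-avoids Q q y) (proj₁ (emb-ord δ x y) x≤y) (x≢y ∘ emb-inj δ)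

-- The color 0 given to q is irrelevant: properness away from q never looks at it.
fill-deleted : ∀ Q q → Coloring (delete Q q) → Coloring Q
fill-deleted Q q c x with x ≟ q
... | yes _ = 0
... | no x≢q = c (proj₁ (deletion-onto Q q x≢q))

fill-deleted-emb : ∀ Q q c → fill-deleted Q q c ∘ emb (deletion-copy Q q) ≗ c
fill-deleted-emb Q q c y with emb (deletion-copy Q q) y ≟ q
... | yes δy≡q = ⊥-elim (deletion-avoids Q q y δy≡q)
... | no δy≢q = cong c (emb-inj (deletion-copy Q q) (proj₂ (deletion-onto Q q δy≢q)))

forcesAvoiding⇒forces-delete : ∀ Q q → ForcesAvoiding Q q P → RainbowForces (delete Q q) P
forcesAvoiding⇒forces-delete Q q H c proper =
  f′ , rainbow-resp-≗ f′ (fill-deleted-emb Q q c) (factor-rainbow f δ (deletion-onto Q q ∘ avoids) (fill-deleted Q q c) rainbow)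
  where
  δ = deletion-copy Q q
  filled-proper : ProperAway Q q (fill-deleted Q q c)
  filled-proper x y x≢q y≢q x≤y x≢y with deletion-onto Q q x≢q | deletion-onto Q q y≢q
  ... | x′ , refl | y′ , refl rewrite fill-deleted-emb Q q c x′ | fill-deleted-emb Q q c y′ =
    proper x′ y′ (proj₂ (emb-ord δ x′ y′) x≤y) (x≢y ∘ cong (emb δ))
  copy = H (fill-deleted Q q c) filled-proper
  f = proj₁ copy
  rainbow = proj₁ (proj₂ copy)
  avoids = proj₂ (proj₂ copy)
  f′ = factor f δ (deletion-onto Q q ∘ avoids)

forces-dual : RainbowForces Q P → RainbowForces (dual Q) (dual P)
forces-dual H c proper = dual-copy (proj₁ copy) , proj₂ copy
  where copy = H c λ x y x≤y x≢y e → proper y x x≤y (x≢y ∘ sym) (sym e)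

forcesAvoiding-dual : ∀ {q} → ForcesAvoiding Q q P → ForcesAvoiding (dual Q) q (dual P)
forcesAvoiding-dual H c proper = dual-copy (proj₁ copy) , proj₂ copy
  where copy = H c λ x y x≢q y≢q x≤y x≢y e → proper y x y≢q x≢q x≤y (x≢y ∘ sym) (sym e)

noDeletionForces-dual : NoDeletionForces Q P → NoDeletionForces (dual Q) (dual P)
noDeletionForces-dual none q = none q ∘ forcesAvoiding-dual

forcesAvoiding-mono : ∀ {q q′} → ForcesAvoiding Q q P →
  (φ : Copy Q Q′) → emb φ q ≡ q′ → Copy P′ P → ForcesAvoiding Q′ q′ P′
forcesAvoiding-mono H φ refl ψ c proper =
  φ ∘ᶜ f ∘ᶜ ψ , (λ x y e → emb-inj ψ (rainbow _ _ e)) , λ p → avoids (emb ψ p) ∘ emb-inj φ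
  where
  copy = H (c ∘ emb φ) λ x y x≢q y≢q x≤y x≢y →
    proper _ _ (x≢q ∘ emb-inj φ) (y≢q ∘ emb-inj φ) (proj₁ (emb-ord φ x y) x≤y) (x≢y ∘ emb-inj φ)
  f = proj₁ copy
  rainbow = proj₁ (proj₂ copy)
  avoids = proj₂ (proj₂ copy)

↑ˡ≢↑ʳ : ∀ {m n} (a : Fin m) (b : Fin n) → a ↑ˡ n ≢ m ↑ʳ b
↑ˡ≢↑ʳ {m} {n} a b e with trans (sym (splitAt-↑ˡ m a n)) (trans (cong (splitAt m) e) (splitAt-↑ʳ m n b))
... | ()

lower-or-upper : ∀ m {n} (x : Fin (m + n)) → (∃ λ a → a ↑ˡ n ≡ x) ⊎ (∃ λ b → m ↑ʳ b ≡ x)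
lower-or-upper m x with splitAt m x in eq
... | inj₁ a = inj₁ (a , splitAt⁻¹-↑ˡ eq)
... | inj₂ b = inj₂ (b , splitAt⁻¹-↑ʳ eq)

upper? : ∀ m {n} (x : Fin (m + n)) → Dec (∃ λ b → m ↑ʳ b ≡ x)
upper? m x with lower-or-upper m x
... | inj₁ (a , refl) = no λ (b , e) → ↑ˡ≢↑ʳ a b (sym e)
... | inj₂ upper = yes upper

module _ (A B : FinPoset) where
  private
    m = size A
    n = size B
    _⊑_ = _≤_ (ordSum A B)

  lower-copy : Copy A (ordSum A B)
  lower-copy = mkCopy (_↑ˡ n) ord
    where
    ord : OrderEmbedding A (ordSum A B) (_↑ˡ n)
    ord a a′ rewrite splitAt-↑ˡ m a n | splitAt-↑ˡ m a′ n = id , id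

  upper-copy : Copy B (ordSum A B)
  upper-copy = mkCopy (m ↑ʳ_) ord
    where
    ord : OrderEmbedding B (ordSum A B) (m ↑ʳ_)
    ord b b′ rewrite splitAt-↑ʳ m n b | splitAt-↑ʳ m n b′ = id , id

  lower⊑upper : ∀ a b → (a ↑ˡ n) ⊑ (m ↑ʳ b)
  lower⊑upper a b rewrite splitAt-↑ˡ m a n | splitAt-↑ʳ m n b = tt

  upper⋢lower : ∀ a b → ¬ (m ↑ʳ b) ⊑ (a ↑ˡ n)
  upper⋢lower a b rewrite splitAt-↑ˡ m a n | splitAt-↑ʳ m n b = λ ()

  upper-upClosed : ∀ {x y} → x ⊑ y → ∃ (λ b → m ↑ʳ b ≡ x) → ∃ λ b → m ↑ʳ b ≡ y
  upper-upClosed {y = y} x⊑y (b , refl) with lower-or-upper m y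
  ... | inj₁ (a , refl) = ⊥-elim (upper⋢lower a b x⊑y)
  ... | inj₂ upper = upper

ordSum-copy : Copy P₁ Q₁ → Copy P₂ Q₂ → Copy (ordSum P₁ P₂) (ordSum Q₁ Q₂)
ordSum-copy {P₁} {Q₁} {P₂} {Q₂} f₁ f₂ = mkCopy (join _ _ ∘ F ∘ splitAt (size P₁)) ord
  where
  F = Sum.map (emb f₁) (emb f₂)
  RP = sumRel (_≤_ P₁) (_≤_ P₂)
  RQ = sumRel (_≤_ Q₁) (_≤_ Q₂)
  F-ord : ∀ u v → (RP u v → RQ (F u) (F v)) × (RQ (F u) (F v) → RP u v)
  F-ord (inj₁ a) (inj₁ a′) = emb-ord f₁ a a′
  F-ord (inj₁ _) (inj₂ _) = _
  F-ord (inj₂ _) (inj₁ _) = (λ ()) , (λ ())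
  F-ord (inj₂ b) (inj₂ b′) = emb-ord f₂ b b′
  ord : OrderEmbedding (ordSum P₁ P₂) (ordSum Q₁ Q₂) (join _ _ ∘ F ∘ splitAt (size P₁))
  ord x y rewrite splitAt-join (size Q₁) (size Q₂) (F (splitAt (size P₁) x))
                | splitAt-join (size Q₁) (size Q₂) (F (splitAt (size P₁) y)) =
    F-ord (splitAt (size P₁) x) (splitAt (size P₁) y)

ordSum-forces : RainbowForces Q₁ P₁ → RainbowForces Q₂ P₂ → RainbowForces (ordSum Q₁ Q₂) (ordSum P₁ P₂)
ordSum-forces {Q₁} {P₁} {Q₂} {P₂} H₁ H₂ c proper = F , rainbow
  where
  copy₁ = H₁ (c ∘ emb (lower-copy Q₁ Q₂)) (proper-∘ (lower-copy Q₁ Q₂) proper)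
  copy₂ = H₂ (c ∘ emb (upper-copy Q₁ Q₂)) (proper-∘ (upper-copy Q₁ Q₂) proper)
  F = ordSum-copy (proj₁ copy₁) (proj₁ copy₂)
  F-↑ˡ : ∀ a → emb F (a ↑ˡ size P₂) ≡ emb (proj₁ copy₁) a ↑ˡ size Q₂
  F-↑ˡ a = cong (join _ _ ∘ Sum.map (emb (proj₁ copy₁)) (emb (proj₁ copy₂))) (splitAt-↑ˡ _ a _)
  F-↑ʳ : ∀ b → emb F (size P₁ ↑ʳ b) ≡ size Q₁ ↑ʳ emb (proj₁ copy₂) b
  F-↑ʳ b = cong (join _ _ ∘ Sum.map (emb (proj₁ copy₁)) (emb (proj₁ copy₂))) (splitAt-↑ʳ _ _ b)
  apart : ∀ a b → c (emb F (a ↑ˡ size P₂)) ≢ c (emb F (size P₁ ↑ʳ b))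
  apart a b = proper _ _ (proj₁ (emb-ord F _ _) (lower⊑upper P₁ P₂ a b)) (↑ˡ≢↑ʳ a b ∘ emb-inj F)
  rainbow : Rainbow c F
  rainbow x y with lower-or-upper (size P₁) x | lower-or-upper (size P₁) y
  ... | inj₁ (a , refl) | inj₁ (a′ , refl) rewrite F-↑ˡ a | F-↑ˡ a′ = cong (_↑ˡ _) ∘ proj₂ copy₁ a a′
  ... | inj₁ (a , refl) | inj₂ (b , refl) = ⊥-elim ∘ apart a b
  ... | inj₂ (b , refl) | inj₁ (a , refl) = ⊥-elim ∘ apart a b ∘ sym
  ... | inj₂ (b , refl) | inj₂ (b′ , refl) rewrite F-↑ʳ b | F-↑ʳ b′ = cong (_ ↑ʳ_) ∘ proj₂ copy₂ b b′

module _ (Q₁ Q₂ : FinPoset) (c₁ : Coloring Q₁) (c₂ : Coloring Q₂) where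
  private
    m = size Q₁
    n = size Q₂

  -- Every lower element lies below every upper one, hence the disjoint palettes.
  ordSum-coloring : Coloring (ordSum Q₁ Q₂)
  ordSum-coloring = [ (λ a → 2 * c₁ a) , (λ b → suc (2 * c₂ b)) ]′ ∘ splitAt m

  ordSum-coloring-↑ˡ : ∀ a → ordSum-coloring (a ↑ˡ n) ≡ 2 * c₁ a
  ordSum-coloring-↑ˡ a = cong [ _ , _ ]′ (splitAt-↑ˡ m a n)

  ordSum-coloring-↑ʳ : ∀ b → ordSum-coloring (m ↑ʳ b) ≡ suc (2 * c₂ b)
  ordSum-coloring-↑ʳ b = cong [ _ , _ ]′ (splitAt-↑ʳ m n b)

  ordSum-coloring-properAway : ∀ {q} → ProperAway Q₁ q c₁ → Proper Q₂ c₂ →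
    ProperAway (ordSum Q₁ Q₂) (q ↑ˡ n) ordSum-coloring
  ordSum-coloring-properAway proper₁ proper₂ x y x≢q y≢q x≤y x≢y with lower-or-upper m x | lower-or-upper m y
  ... | inj₁ (a , refl) | inj₁ (a′ , refl) rewrite ordSum-coloring-↑ˡ a | ordSum-coloring-↑ˡ a′ =
    proper₁ a a′ (x≢q ∘ cong (_↑ˡ n)) (y≢q ∘ cong (_↑ˡ n)) (proj₂ (emb-ord (lower-copy Q₁ Q₂) a a′) x≤y)
      (x≢y ∘ cong (_↑ˡ n)) ∘ *-cancelˡ-≡ _ _ 2
  ... | inj₁ (a , refl) | inj₂ (b , refl) rewrite ordSum-coloring-↑ˡ a | ordSum-coloring-↑ʳ b =
    even≢odd (c₁ a) (c₂ b)
  ... | inj₂ (b , refl) | inj₁ (a , refl) = ⊥-elim (upper⋢lower Q₁ Q₂ a b x≤y)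
  ... | inj₂ (b , refl) | inj₂ (b′ , refl) rewrite ordSum-coloring-↑ʳ b | ordSum-coloring-↑ʳ b′ =
    proper₂ b b′ (proj₂ (emb-ord (upper-copy Q₁ Q₂) b b′) x≤y) (x≢y ∘ cong (m ↑ʳ_))
      ∘ *-cancelˡ-≡ _ _ 2 ∘ suc-injective

RainbowCopyAbove : (P Q : FinPoset) → Coloring Q → Set
RainbowCopyAbove P Q c =
  ∃ λ y → Σ (Copy P Q) λ g → Rainbow c g × (∀ p → _≤_ Q y (emb g p) × y ≢ emb g p)

module _ {P₁ P₂ Q₁ Q₂ : FinPoset} (c₁ : Coloring Q₁) (c₂ : Coloring Q₂)
         (G : Copy (ordSum P₁ P₂) (ordSum Q₁ Q₂)) (rainbow : Rainbow (ordSum-coloring Q₁ Q₂ c₁ c₂) G) where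
  private
    c = ordSum-coloring Q₁ Q₂ c₁ c₂
    G↑ˡ⊑G↑ʳ : ∀ p₁ p₂ → _≤_ (ordSum Q₁ Q₂) (emb G (p₁ ↑ˡ size P₂)) (emb G (size P₁ ↑ʳ p₂))
    G↑ˡ⊑G↑ʳ p₁ p₂ = proj₁ (emb-ord G _ _) (lower⊑upper P₁ P₂ p₁ p₂)

  restrict-lower : (∀ p → ¬ ∃ λ b → size Q₁ ↑ʳ b ≡ emb G (p ↑ˡ size P₂)) →
    Σ (Copy P₁ Q₁) λ g → Rainbow c₁ g × (∀ p → emb g p ↑ˡ size Q₂ ≡ emb G (p ↑ˡ size P₂))
  restrict-lower none-upper = g , rainbow₁ , proj₂ ∘ images
    where
    G₁ = G ∘ᶜ lower-copy P₁ P₂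
    images : ∀ p → ∃ λ a → a ↑ˡ size Q₂ ≡ emb G₁ p
    images p with lower-or-upper (size Q₁) (emb G₁ p)
    ... | inj₁ lower = lower
    ... | inj₂ upper = ⊥-elim (none-upper p upper)
    g = factor G₁ (lower-copy Q₁ Q₂) images
    rainbow₁ : Rainbow c₁ g
    rainbow₁ x y = rainbow-resp-≗ g (ordSum-coloring-↑ˡ Q₁ Q₂ c₁ c₂)
      (factor-rainbow G₁ (lower-copy Q₁ Q₂) images c (λ _ _ → emb-inj (lower-copy P₁ P₂) ∘ rainbow _ _)) x y
      ∘ cong (2 *_)

  restrict-upper : ∀ p₁ y → size Q₁ ↑ʳ y ≡ emb G (p₁ ↑ˡ size P₂) → RainbowCopyAbove P₂ Q₂ c₂
  restrict-upper p₁ y y≡Gp₁ = y , g , rainbow₂ , above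
    where
    G₂ = G ∘ᶜ upper-copy P₁ P₂
    images : ∀ p → ∃ λ b → size Q₁ ↑ʳ b ≡ emb G₂ p
    images p = upper-upClosed Q₁ Q₂ (G↑ˡ⊑G↑ʳ p₁ p) (y , y≡Gp₁)
    g = factor G₂ (upper-copy Q₁ Q₂) images
    rainbow₂ : Rainbow c₂ g
    rainbow₂ x y = rainbow-resp-≗ g (ordSum-coloring-↑ʳ Q₁ Q₂ c₁ c₂)
      (factor-rainbow G₂ (upper-copy Q₁ Q₂) images c (λ _ _ → emb-inj (upper-copy P₁ P₂) ∘ rainbow _ _)) x y
      ∘ cong (λ k → 1 + 2 * k)
    above : ∀ p → _≤_ Q₂ y (emb g p) × y ≢ emb g p
    above p =
        proj₂ (emb-ord (upper-copy Q₁ Q₂) _ _)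
          (subst₂ (_≤_ (ordSum Q₁ Q₂)) (sym y≡Gp₁) (sym (proj₂ (images p))) (G↑ˡ⊑G↑ʳ p₁ p))
      , λ y≡gp → ↑ˡ≢↑ʳ p₁ p (emb-inj G (trans (sym y≡Gp₁) (trans (cong (_ ↑ʳ_) y≡gp) (proj₂ (images p)))))

forcesAvoiding-ordSum-lower : ∀ {q} → ForcesAvoiding (ordSum Q₁ Q₂) (q ↑ˡ size Q₂) (ordSum P₁ P₂) →
  ∀ {c₂} → Proper Q₂ c₂ → ¬ RainbowCopyAbove P₂ Q₂ c₂ → ForcesAvoiding Q₁ q P₁
forcesAvoiding-ordSum-lower {Q₁} {Q₂} {P₁} {P₂} H {c₂} proper₂ no-copy-above c₁ proper₁
  with H (ordSum-coloring Q₁ Q₂ c₁ c₂) (ordSum-coloring-properAway Q₁ Q₂ c₁ c₂ proper₁ proper₂)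
... | G , rainbow , avoids with any? (λ p → upper? (size Q₁) (emb G (p ↑ˡ size P₂)))
...   | yes (p₁ , y , y≡Gp₁) = ⊥-elim (no-copy-above (restrict-upper c₁ c₂ G rainbow p₁ y y≡Gp₁))
...   | no none-upper =
  let g , rainbow₁ , g≡G = restrict-lower c₁ c₂ G rainbow (λ p upper → none-upper (p , upper))
  in g , rainbow₁ , λ p gp≡q → avoids (p ↑ˡ size P₂) (trans (sym (g≡G p)) (cong (_↑ˡ size Q₂) gp≡q))

fresh-at : ∀ Q → El Q → Coloring Q → Coloring Q
fresh-at Q m c y with y ≟ m
... | yes _ = 0
... | no _ = suc (c y)

fresh-at-≢ : ∀ Q m c {y} → y ≢ m → fresh-at Q m c y ≡ suc (c y)
fresh-at-≢ Q m c {y} y≢m with y ≟ m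
... | yes y≡m = ⊥-elim (y≢m y≡m)
... | no _ = refl

fresh-at-proper : ∀ {m c} → ProperAway Q m c → Proper Q (fresh-at Q m c)
fresh-at-proper {m = m} proper x y x≤y x≢y with x ≟ m | y ≟ m
... | yes refl | yes refl = ⊥-elim (x≢y refl)
... | yes _ | no _ = λ ()
... | no _ | yes _ = λ ()
... | no x≢m | no y≢m = proper x y x≢m y≢m x≤y x≢y ∘ suc-injective

-- A copy above y that met the minimal m would force y = m.
fresh-at-noCopyAbove : ∀ {m c} → IsMinimal Q m → ¬ RainbowCopyAvoiding P Q m c →
  ¬ RainbowCopyAbove P Q (fresh-at Q m c)
fresh-at-noCopyAbove {Q} {m = m} {c} minimal no-copy (y , g , rainbow , above) with any? (λ p → emb g p ≟ m)
... | yes (p , refl) = proj₂ (above p) (minimal y (proj₁ (above p)))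
... | no misses = no-copy (g , rainbow′ , λ p → misses ∘ (p ,_))
  where
  rainbow′ : Rainbow c g
  rainbow′ x x′ e = rainbow x x′
    (trans (fresh-at-≢ Q m c (misses ∘ (x ,_))) (trans (cong suc e) (sym (fresh-at-≢ Q m c (misses ∘ (x′ ,_))))))

rainbowCopyAvoiding? : Decidable (_≤_ P) → Decidable (_≤_ Q) → ∀ q c → Dec (RainbowCopyAvoiding P Q q c)
rainbowCopyAvoiding? {P} {Q} P? Q? q c =
  map′ (λ (f , compatible , avoids) → mkCopy f (λ x y → proj₁ (compatible x y)) , (λ x y → proj₂ (compatible x y)) , avoids)
       (λ (f , rainbow , avoids) → emb f , (λ x y → emb-ord f x y , rainbow x y) , avoids)
       (any-function? resp λ f → (all? λ x → all? λ y → compatible? x y (f x) (f y)) ×-dec all? λ p → ¬? (f p ≟ q))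
  where
  Compatible : El P → El P → El Q → El Q → Set
  Compatible x y u v = ((_≤_ P x y → _≤_ Q u v) × (_≤_ Q u v → _≤_ P x y)) × (c u ≡ c v → x ≡ y)
  compatible? : ∀ x y u v → Dec (Compatible x y u v)
  compatible? x y u v = ((P? x y →-dec Q? u v) ×-dec (Q? u v →-dec P? x y)) ×-dec (c u ≟ℕ c v →-dec x ≟ y)
  resp : ∀ {f g : El P → El Q} → f ≗ g →
    (∀ x y → Compatible x y (f x) (f y)) × (∀ p → f p ≢ q) → (∀ x y → Compatible x y (g x) (g y)) × (∀ p → g p ≢ q)
  resp f≗g (compatible , avoids) =
    (λ x y → subst₂ (Compatible x y) (f≗g x) (f≗g y) (compatible x y)) , λ p → avoids p ∘ trans (f≗g p)

¬¬-proper-noCopyAbove : NoDeletionForces Q P → ¬ ¬ Σ (Coloring Q) λ c → Proper Q c × ¬ RainbowCopyAbove P Q c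
¬¬-proper-noCopyAbove {Q} {P} none k =
  ¬¬-decidable Q λ Q? → ¬¬-decidable P λ P? → choose Q? P? (fin-empty-or-inhabited (size Q))
  where
  choose : Decidable (_≤_ Q) → Decidable (_≤_ P) → ¬ El Q ⊎ El Q → ⊥
  choose _ _ (inj₁ empty) = k ((λ _ → 0) , (λ x → ⊥-elim (empty x)) , empty ∘ proj₁)
  choose Q? P? (inj₂ x) =
    let m , minimal = minimal-exists {Q} Q? x in
    none m λ c proper → decidable-stable (rainbowCopyAvoiding? P? Q? m c) λ no-copy →
      k (fresh-at Q m c , fresh-at-proper proper , fresh-at-noCopyAbove minimal no-copy)

ordSum-noDeletionForces-lower : NoDeletionForces Q₁ P₁ → NoDeletionForces Q₂ P₂ →
  ∀ q → ¬ ForcesAvoiding (ordSum Q₁ Q₂) (q ↑ˡ size Q₂) (ordSum P₁ P₂)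
ordSum-noDeletionForces-lower none₁ none₂ q H =
  ¬¬-proper-noCopyAbove none₂ λ (_ , proper₂ , no-copy-above) →
    none₁ q (forcesAvoiding-ordSum-lower H proper₂ no-copy-above)

ordSum-dual-copy : ∀ A B → Copy (dual (ordSum A B)) (ordSum (dual B) (dual A))
ordSum-dual-copy A B = mkCopy (join _ _ ∘ Sum.swap ∘ splitAt (size A)) ord
  where
  RA = sumRel (_≤_ A) (_≤_ B)
  RB = sumRel (flip (_≤_ B)) (flip (_≤_ A))
  swapped : ∀ u v → (RA v u → RB (Sum.swap u) (Sum.swap v)) × (RB (Sum.swap u) (Sum.swap v) → RA v u)
  swapped (inj₁ _) (inj₁ _) = id , id
  swapped (inj₁ _) (inj₂ _) = id , id
  swapped (inj₂ _) (inj₁ _) = id , id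
  swapped (inj₂ _) (inj₂ _) = id , id
  ord : OrderEmbedding (dual (ordSum A B)) (ordSum (dual B) (dual A)) (join _ _ ∘ Sum.swap ∘ splitAt (size A))
  ord x y rewrite splitAt-join (size B) (size A) (Sum.swap (splitAt (size A) x))
                | splitAt-join (size B) (size A) (Sum.swap (splitAt (size A) y)) =
    swapped (splitAt (size A) x) (splitAt (size A) y)

ordSum-dual-copy-↑ʳ : ∀ A B b → emb (ordSum-dual-copy A B) (size A ↑ʳ b) ≡ b ↑ˡ size A
ordSum-dual-copy-↑ʳ A B b = cong (join _ _ ∘ Sum.swap) (splitAt-↑ʳ (size A) (size B) b)

ordSum-noDeletionForces : NoDeletionForces Q₁ P₁ → NoDeletionForces Q₂ P₂ →
  NoDeletionForces (ordSum Q₁ Q₂) (ordSum P₁ P₂)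
ordSum-noDeletionForces {Q₁} {P₁} {Q₂} {P₂} none₁ none₂ x H with lower-or-upper (size Q₁) x
... | inj₁ (q , refl) = ordSum-noDeletionForces-lower none₁ none₂ q H
... | inj₂ (q , refl) =
  ordSum-noDeletionForces-lower (noDeletionForces-dual none₂) (noDeletionForces-dual none₁) q
    (forcesAvoiding-mono (forcesAvoiding-dual H) (ordSum-dual-copy Q₁ Q₂) (ordSum-dual-copy-↑ʳ Q₁ Q₂ q)
      (dual-copy (ordSum-dual-copy (dual P₂) (dual P₁))))

noDeletionForces : (∀ q → ¬ RainbowForces (delete Q q) P) → NoDeletionForces Q P
noDeletionForces {Q} minimal q = minimal q ∘ forcesAvoiding⇒forces-delete Q q

noDeletionForces⁻ : NoDeletionForces Q P → ∀ q → ¬ RainbowForces (delete Q q) P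
noDeletionForces⁻ {Q} none q = none q ∘ forces-delete⇒forcesAvoiding Q q

M-dual : M P Q → M (dual P) (dual Q)
M-dual (forces , minimal) =
  forces-dual forces , noDeletionForces⁻ (noDeletionForces-dual (noDeletionForces minimal))

M-ordSum : M P₁ Q₁ → M P₂ Q₂ → M (ordSum P₁ P₂) (ordSum Q₁ Q₂)
M-ordSum (forces₁ , minimal₁) (forces₂ , minimal₂) =
    ordSum-forces forces₁ forces₂
  , noDeletionForces⁻ (ordSum-noDeletionForces (noDeletionForces minimal₁) (noDeletionForces minimal₂))

lemma2p3 : (P₁ P₂ Q₁ Q₂ : FinPoset) → M P₁ Q₁ → M P₂ Q₂ →
    M (dual P₁) (dual Q₁) × M (ordSum P₁ P₂) (ordSum Q₁ Q₂)
lemma2p3 P₁ P₂ Q₁ Q₂ M₁ M₂ = M-dual M₁ , M-ordSum M₁ M₂
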